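{- The following holds for every connected graph $G$. \begin{enumerate} \item $\{A_\alpha\}_{\alpha\in\mathrm{Sub}(G)}$ is a partition of $V(G)$ into non-empty sets. \item $(T,\{B_\alpha\}_{\alpha\in\mathrm{Sub}(G)})$ is a tree decomposition of $G$. \item $|B_\alpha|\leq t$ for every $\alpha\in\mathrm{Sub}(G)$. \end{enumerate}
   Context: Let $G$ be a connected graph with a fixed rooted tree decomposition $(T',\{B'_x\}_{x\in V(T')})$ of width at most $t-1$. For a node $x$ of $T'$, let $T'_x$ be the subtree of $T'$ consisting of $x$ and all nodes below $x$, and let $V'_x$ be the set of vertices of $G$ contained only in bags of $T'_x$. Let $\mathrm{Sub}(G)$ be the union, over all nodes $x$ of $T'$, of the families of connected components of $G[V'_x]$. Then $G\in\mathrm{Sub}(G)$, and for any two members their vertex sets are nested or disjoint, and disjoint members are non-adjacent; hence the members of $\mathrm{Sub}(G)$ form a rooted tree $T$ with root $G$ in which descendants have vertex sets contained in their ancestors' and incomparable nodes have disjoint, non-adjacent vertex sets. For $\alpha\in\mathrm{Sub}(G)$, let $A_\alpha$ be the set of vertices $v\in V(G)$ for which $\alpha$ is the smallest member of $\mathrm{Sub}(G)$ containing $v$, and let $B_\alpha=A_\alpha\cup N_G(V(\alpha))$, where $N_G(X)$ denotes the set of vertices not in $X$ adjacent to some vertex of $X$. -}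

module Defs where

open import Data.Nat using (ℕ; _≤_; _<_)
open import Data.Fin using (Fin)
open import Data.Fin.Subset using (Subset; _∈_; _∉_; _⊆_; ∣_∣)
open import Data.Bool using (Bool; T)
open import Data.Product using (Σ; ∃; _×_; _,_)
open import Data.Sum using (_⊎_)
open import Data.Unit using (⊤)
open import Relation.Nullary using (¬_)
open import Relation.Binary.PropositionalEquality using (_≡_; _≢_)
open import Function.Bundles using (_⇔_)

record Graph (n : ℕ) : Set where
  field
    adj    : Fin n → Fin n → Bool
    sym    : ∀ u v → T (adj u v) → T (adj v u)
    irrefl : ∀ v → ¬ T (adj v v)

  Adj : Fin n → Fin n → Set
  Adj u v = T (adj u v)

open Graph public

data Walk {A : Set} (P : A → Set) (E : A → A → Set) : A → A → Set where
  nil  : ∀ {x} → P x → Walk P E x x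
  cons : ∀ {x y z} → P x → E x y → Walk P E y z → Walk P E x z

Connected : ∀ {n} → Graph n → Set
Connected {n} G = Fin n × (∀ u v → Walk (λ _ → ⊤) (Adj G) u v)

-- C is (the vertex set of) a connected component of G[S].
IsComponent : ∀ {n} → Graph n → (Fin n → Set) → Subset n → Set
IsComponent {n} G S C =
  (∃ λ v → v ∈ C)
  × (∀ v → v ∈ C → S v)
  × (∀ u v → u ∈ C → v ∈ C → Walk (λ w → w ∈ C) (Adj G) u v)
  × (∀ u w → u ∈ C → S w → Adj G u w → w ∈ C)

record IsTreeDecomposition {n : ℕ} (G : Graph n) {I : Set} (Node : I → Set)
         (TE : I → I → Set) (Bag : I → Fin n → Set) : Set where
  field
    cover    : ∀ v → ∃ λ x → Node x × Bag x v
    edge     : ∀ u v → Adj G u v → ∃ λ x → Node x × Bag x u × Bag x v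
    coherent : ∀ v x y → Node x → Node y → Bag x v → Bag y v →
               Walk (λ z → Node z × Bag z v) TE x y

-- Rooted trees on node set Fin m (parent of the root is the root itself;
-- a height function strictly decreasing along parent edges ensures the
-- parent structure is a rooted tree).

record RootedTree (m : ℕ) : Set where
  field
    root        : Fin m
    parent      : Fin m → Fin m
    parent-root : parent root ≡ root
    height      : Fin m → ℕ
    height-dec  : ∀ x → x ≢ root → height (parent x) < height x

  TEdge : Fin m → Fin m → Set
  TEdge x y = (x ≢ root × parent x ≡ y) ⊎ (y ≢ root × parent y ≡ x)

  -- y ⊑ x : y is x or a descendant of x (i.e. y is a node of T'_x)
  data _⊑_ : Fin m → Fin m → Set where
    here : ∀ {x} → x ⊑ x
    up   : ∀ {y x} → y ≢ root → parent y ⊑ x → y ⊑ x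

open RootedTree public

module Construction {n m : ℕ} (G : Graph n) (T' : RootedTree m)
                    (B' : Fin m → Subset n) where

  V' : Fin m → Fin n → Set
  V' x v = ∀ y → v ∈ B' y → _⊑_ T' y x

  -- membership in Sub(G) (members identified with their vertex sets)
  IsSub : Subset n → Set
  IsSub C = ∃ λ x → IsComponent G (V' x) C

  ParentT : Subset n → Subset n → Set
  ParentT β α = IsSub α × IsSub β × α ⊆ β × α ≢ β
              × (∀ γ → IsSub γ → α ⊆ γ → α ≢ γ → β ⊆ γ)

  TE : Subset n → Subset n → Set
  TE α β = ParentT α β ⊎ ParentT β α

  A : Subset n → Fin n → Set
  A α v = v ∈ α × (∀ γ → IsSub γ → v ∈ γ → α ⊆ γ)

  Nbr : Subset n → Fin n → Set
  Nbr α u = u ∉ α × ∃ λ w → w ∈ α × Adj G w u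

  B : Subset n → Fin n → Set
  B α v = A α v ⊎ Nbr α v

CardLe : ∀ {n} → (Fin n → Set) → ℕ → Set
CardLe {n} P t = ∃ λ (S : Subset n) → (∀ v → (v ∈ S) ⇔ P v) × ∣ S ∣ ≤ t

{-# OPTIONS --safe #-}
module Submission where

-- Every member α of Sub(G) is a component of G[V'_x] for a node x whose bag B'_x
-- meets α: while α avoids the bag, α lies below a single child of x, so we may
-- descend.  For such an x, A_α = α ∩ B'_x, and every neighbour of α lies in B'_x
-- (otherwise it would belong to V'_x and hence to α); so B_α ⊆ B'_x.  Two members
-- sharing a vertex or joined by an edge are nested, since the corresponding nodes
-- of T' are comparable.  For coherence, walk in T from a member α with v ∈ B_α up
-- through parents to the smallest member containing v: v is a neighbour of every
-- member strictly before it.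

open import Defs
open import Data.Nat using (ℕ; _≤_; _<_; _∸_)
open import Data.Nat.Properties using (∸-monoʳ-<; <⇒≱; <⇒≤; ≤-refl; ≤-trans)
open import Data.Nat.Induction using (<-wellFounded)
open import Data.Fin using (Fin) renaming (_≟_ to _≟ᶠ_)
open import Data.Fin.Subset using (Subset; _∈_; _∉_; _⊆_; _⊂_; _⊃_; _∪_; ⁅_⁆; ∣_∣)
open import Data.Fin.Subset.Properties
  using (_∈?_; _⊂?_; ⊆-refl; ⊆-trans; ⊆-antisym; ⊂-irref; p⊆q⇒∣p∣≤∣q∣; p⊆p∪q; q⊆p∪q; x∈p∪q⁻; x∈⁅x⁆; x∈⁅y⁆⇒x≡y)
open import Data.Fin.Subset.Induction using (⊂-wellFounded; ⊃-wellFounded)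
open import Data.Fin.Properties using (any?; all?)
open import Data.Vec using (tabulate)
open import Data.Vec.Properties using (lookup∘tabulate; []=⇒lookup; lookup⇒[]=; ≡-dec)
open import Data.Bool using (true)
open import Data.Bool.Properties using () renaming (_≟_ to _≟ᵇ_)
open import Data.List using (map; allFin)
import Data.List.Relation.Unary.All as All
open import Data.List.Membership.Propositional.Properties using (∈-map⁺; ∈-allFin)
open import Data.List.Extrema.Nat using (max; xs≤max)
open import Data.Product using (∃; ∃₂; _×_; _,_; proj₁; proj₂)
open import Data.Sum using (_⊎_; inj₁; inj₂)
import Data.Sum as Sum
open import Data.Unit using (⊤; tt)
open import Data.Empty using (⊥-elim)
open import Function using (_∘_; id)
open import Function.Bundles using (mk⇔)
open import Induction.WellFounded using (WellFounded; Acc; acc; module Subrelation)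
import Relation.Binary.Construct.On as On
open import Relation.Nullary using (¬_; Dec; yes; no; does; ¬?)
open import Relation.Nullary.Decidable using (_×-dec_; T?; map′; decidable-stable; dec-true; _→-dec_)
open import Relation.Unary using (Decidable)
open import Relation.Binary.Definitions using (DecidableEquality)
open import Relation.Binary.PropositionalEquality using (_≡_; _≢_; refl; trans) renaming (sym to ≡-sym)

module _ {A : Set} {E : A → A → Set} where

  walk-head : ∀ {P x y} → Walk P E x y → P x
  walk-head (nil p)      = p
  walk-head (cons p _ _) = p

  walk-map : ∀ {P Q : A → Set} → (∀ {z} → P z → Q z) → ∀ {x y} → Walk P E x y → Walk Q E x y
  walk-map f (nil p)      = nil (f p)
  walk-map f (cons p e w) = cons (f p) e (walk-map f w)

  infixr 5 _++ʷ_
  _++ʷ_ : ∀ {P x y z} → Walk P E x y → Walk P E y z → Walk P E x z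
  nil _      ++ʷ w′ = w′
  cons p e w ++ʷ w′ = cons p e (w ++ʷ w′)

  walk-reverse : ∀ {P} → (∀ {x y} → E x y → E y x) → ∀ {x y} → Walk P E x y → Walk P E y x
  walk-reverse E-sym (nil p)      = nil p
  walk-reverse E-sym (cons p e w) = walk-reverse E-sym w ++ʷ cons (walk-head w) (E-sym e) (nil p)

  walk-preserves : ∀ {P} (Q : A → Set) → (∀ {a b} → P a → Q a → E a b → P b → Q b) →
                   ∀ {x y} → Walk P E x y → Q x → Q y
  walk-preserves Q step (nil _)       q = q
  walk-preserves Q step (cons pa e w) q = walk-preserves Q step w (step pa q e (walk-head w))

module _ {n : ℕ} where

  _≟ˢ_ : DecidableEquality (Subset n)
  _≟ˢ_ = ≡-dec _≟ᵇ_

  ⊂⇒≢ : ∀ {p q : Subset n} → p ⊂ q → p ≢ q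
  ⊂⇒≢ p⊂q p≡q = ⊂-irref p≡q p⊂q

  ⊆∧≢⇒⊂ : ∀ {p q : Subset n} → p ⊆ q → p ≢ q → p ⊂ q
  ⊆∧≢⇒⊂ {p} {q} p⊆q p≢q with any? (λ x → (x ∈? q) ×-dec ¬? (x ∈? p))
  ... | yes new = p⊆q , new
  ... | no none = ⊥-elim (p≢q (⊆-antisym p⊆q q⊆p))
    where
    q⊆p : q ⊆ p
    q⊆p {x} x∈q = decidable-stable (x ∈? p) (λ x∉p → none (x , x∈q , x∉p))

  ∈-∪-⁅⁆⁻ : ∀ {p : Subset n} {x y} → y ∈ p ∪ ⁅ x ⁆ → y ∈ p ⊎ y ≡ x
  ∈-∪-⁅⁆⁻ {p} {x} = Sum.map₂ (x∈⁅y⁆⇒x≡y x) ∘ x∈p∪q⁻ p ⁅ x ⁆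

  x∉p⇒p⊂p∪⁅x⁆ : ∀ {p : Subset n} {x} → x ∉ p → p ⊂ p ∪ ⁅ x ⁆
  x∉p⇒p⊂p∪⁅x⁆ {p} {x} x∉p = p⊆p∪q ⁅ x ⁆ , x , q⊆p∪q p ⁅ x ⁆ (x∈⁅x⁆ x) , x∉p

  module _ {P : Fin n → Set} (P? : Decidable P) where

    toSubset : Subset n
    toSubset = tabulate (does ∘ P?)

    ∈-toSubset⁺ : ∀ {v} → P v → v ∈ toSubset
    ∈-toSubset⁺ {v} p = lookup⇒[]= v toSubset (trans (lookup∘tabulate _ v) (dec-true (P? v) p))

    ∈-toSubset⁻ : ∀ {v} → v ∈ toSubset → P v
    ∈-toSubset⁻ {v} v∈ = does-true (P? v) (trans (≡-sym (lookup∘tabulate _ v)) ([]=⇒lookup v∈))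
      where
      does-true : ∀ {Q : Set} (q? : Dec Q) → does q? ≡ true → Q
      does-true (yes q) _ = q
      does-true (no _) ()

    CardLe-⊆ : ∀ {S t} → (∀ {v} → P v → v ∈ S) → ∣ S ∣ ≤ t → CardLe P t
    CardLe-⊆ P⊆S ∣S∣≤t =
      toSubset , (λ v → mk⇔ ∈-toSubset⁻ ∈-toSubset⁺) , ≤-trans (p⊆q⇒∣p∣≤∣q∣ (P⊆S ∘ ∈-toSubset⁻)) ∣S∣≤t

module Components {n : ℕ} (G : Graph n) where

  Adj-sym : ∀ {u w} → Adj G u w → Adj G w u
  Adj-sym {u} {w} = Graph.sym G u w

  component-closed-walk : ∀ {S : Fin n → Set} {γ : Subset n} {a b} → IsComponent G S γ →
                          Walk S (Adj G) a b → a ∈ γ → b ∈ γ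
  component-closed-walk {γ = γ} (_ , _ , _ , closed) =
    walk-preserves (_∈ γ) (λ {a} {b} _ a∈γ ab Sb → closed a b a∈γ Sb ab)

  component-⊆ : ∀ {S S′ : Fin n → Set} {α γ : Subset n} {u} → IsComponent G S α → IsComponent G S′ γ →
                (∀ {w} → S w → S′ w) → u ∈ α → u ∈ γ → α ⊆ γ
  component-⊆ {u = u} (_ , α⊆S , connected , _) cγ S⊆S′ u∈α u∈γ a∈α =
    component-closed-walk cγ (walk-map (λ {w} w∈α → S⊆S′ (α⊆S w w∈α)) (connected u _ u∈α a∈α)) u∈γ

  component-unique : ∀ {S : Fin n → Set} {α γ : Subset n} {u} → IsComponent G S α → IsComponent G S γ →
                     u ∈ α → u ∈ γ → α ≡ γ
  component-unique cα cγ u∈α u∈γ =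
    ⊆-antisym (component-⊆ cα cγ id u∈α u∈γ) (component-⊆ cγ cα id u∈γ u∈α)

  module _ {S : Fin n → Set} (S? : Decidable S) where

    private
      Exit : Subset n → Set
      Exit X = ∃₂ λ u w → u ∈ X × w ∉ X × S w × Adj G u w

      exit? : ∀ X → Dec (Exit X)
      exit? X = any? λ u → any? λ w → (u ∈? X) ×-dec ¬? (w ∈? X) ×-dec S? w ×-dec T? (adj G u w)

      grow : (X : Subset n) → Acc _⊃_ X → Subset n
      grow X (acc rs) with exit? X
      ... | yes (_ , w , _ , w∉X , _) = grow (X ∪ ⁅ w ⁆) (rs (x∉p⇒p⊂p∪⁅x⁆ w∉X))
      ... | no _                      = X

      Spanned : Fin n → Subset n → Set
      Spanned v X = v ∈ X × (∀ {w} → w ∈ X → S w) × (∀ {w} → w ∈ X → Walk (_∈ X) (Adj G) w v)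

      spanned-⁅⁆ : ∀ {v} → S v → Spanned v ⁅ v ⁆
      spanned-⁅⁆ {v} Sv = x∈⁅x⁆ v , ⊆S , to-v
        where
        ⊆S : ∀ {w} → w ∈ ⁅ v ⁆ → S w
        ⊆S w∈ with x∈⁅y⁆⇒x≡y v w∈
        ... | refl = Sv
        to-v : ∀ {w} → w ∈ ⁅ v ⁆ → Walk (_∈ ⁅ v ⁆) (Adj G) w v
        to-v w∈ with x∈⁅y⁆⇒x≡y v w∈
        ... | refl = nil w∈

      spanned-∪ : ∀ {v X u w} → Spanned v X → u ∈ X → S w → Adj G u w → Spanned v (X ∪ ⁅ w ⁆)
      spanned-∪ {v} {X} {u} {w} (v∈X , X⊆S , to-v) u∈X Sw uw = grown v∈X , ⊆S , to-v′
        where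
        grown : X ⊆ X ∪ ⁅ w ⁆
        grown = p⊆p∪q ⁅ w ⁆
        ⊆S : ∀ {y} → y ∈ X ∪ ⁅ w ⁆ → S y
        ⊆S y∈ with ∈-∪-⁅⁆⁻ y∈
        ... | inj₁ y∈X = X⊆S y∈X
        ... | inj₂ refl = Sw
        to-v′ : ∀ {y} → y ∈ X ∪ ⁅ w ⁆ → Walk (_∈ X ∪ ⁅ w ⁆) (Adj G) y v
        to-v′ y∈ with ∈-∪-⁅⁆⁻ y∈
        ... | inj₁ y∈X = walk-map grown (to-v y∈X)
        ... | inj₂ refl = cons y∈ (Adj-sym uw) (walk-map grown (to-v u∈X))

      closed-isComponent : ∀ {v X} → Spanned v X → ¬ Exit X → IsComponent G S X
      closed-isComponent {v} {X} (v∈X , X⊆S , to-v) no-exit =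
        (v , v∈X) , (λ _ → X⊆S) ,
        (λ a b a∈X b∈X → to-v a∈X ++ʷ walk-reverse Adj-sym (to-v b∈X)) , closed
        where
        closed : ∀ u w → u ∈ X → S w → Adj G u w → w ∈ X
        closed u w u∈X Sw uw = decidable-stable (w ∈? X) (λ w∉X → no-exit (u , w , u∈X , w∉X , Sw , uw))

      grow-isComponent : ∀ {v} X (a : Acc _⊃_ X) → Spanned v X → IsComponent G S (grow X a) × v ∈ grow X a
      grow-isComponent X (acc rs) spanned with exit? X
      ... | yes (u , w , u∈X , w∉X , Sw , uw) =
        grow-isComponent (X ∪ ⁅ w ⁆) (rs (x∉p⇒p⊂p∪⁅x⁆ w∉X)) (spanned-∪ spanned u∈X Sw uw)
      ... | no no-exit = closed-isComponent spanned no-exit , proj₁ spanned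

    componentOf : Fin n → Subset n
    componentOf v = grow ⁅ v ⁆ (⊃-wellFounded ⁅ v ⁆)

    componentOf-isComponent : ∀ {v} → S v → IsComponent G S (componentOf v) × v ∈ componentOf v
    componentOf-isComponent Sv = grow-isComponent _ _ (spanned-⁅⁆ Sv)

module RootedTreeProperties {m : ℕ} (T : RootedTree m) where

  infix 4 _≼_
  _≼_ : Fin m → Fin m → Set
  y ≼ x = _⊑_ T y x

  ≼-trans : ∀ {y x z} → y ≼ x → x ≼ z → y ≼ z
  ≼-trans here       x≼z = x≼z
  ≼-trans (up y≢r p) x≼z = up y≢r (≼-trans p x≼z)

  ≼-height : ∀ {y x} → y ≼ x → height T x ≤ height T y
  ≼-height here           = ≤-refl
  ≼-height (up {y} y≢r p) = ≤-trans (≼-height p) (<⇒≤ (height-dec T y y≢r))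

  private
    ≼-root′ : ∀ y → Acc _<_ (height T y) → y ≼ root T
    ≼-root′ y (acc rs) with y ≟ᶠ root T
    ... | yes refl = here
    ... | no y≢r   = up y≢r (≼-root′ (parent T y) (rs (height-dec T y y≢r)))

    ≼-dec′ : ∀ y x → Acc _<_ (height T y) → Dec (y ≼ x)
    ≼-dec′ y x (acc rs) with y ≟ᶠ x | y ≟ᶠ root T
    ... | yes refl | _        = yes here
    ... | no y≢x   | yes refl = no λ { here → y≢x refl ; (up y≢r _) → y≢r refl }
    ... | no y≢x   | no y≢r   = map′ (up y≢r) (λ { here → ⊥-elim (y≢x refl) ; (up _ p) → p })
                                     (≼-dec′ (parent T y) x (rs (height-dec T y y≢r)))

  ≼-root : ∀ y → y ≼ root T
  ≼-root y = ≼-root′ y (<-wellFounded (height T y))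

  _≼?_ : ∀ y x → Dec (y ≼ x)
  y ≼? x = ≼-dec′ y x (<-wellFounded (height T y))

  ≼-comparable : ∀ {y x z} → y ≼ x → y ≼ z → x ≼ z ⊎ z ≼ x
  ≼-comparable here      y≼z      = inj₁ y≼z
  ≼-comparable (up y≢r p) here    = inj₂ (up y≢r p)
  ≼-comparable (up _ p)  (up _ q) = ≼-comparable p q

  Child : Fin m → Fin m → Set
  Child c x = c ≢ root T × parent T c ≡ x

  child≼ : ∀ {c x} → Child c x → c ≼ x
  child≼ (c≢r , refl) = up c≢r here

  ≼-child : ∀ {y x} → y ≼ x → y ≢ x → ∃ λ c → Child c x × y ≼ c
  ≼-child here         y≢x = ⊥-elim (y≢x refl)
  ≼-child {y} {x} (up y≢r p) _ with parent T y ≟ᶠ x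
  ... | yes py≡x = y , (y≢r , py≡x) , here
  ... | no py≢x with ≼-child p py≢x
  ...   | c , ch , py≼c = c , ch , up y≢r py≼c

  child-height : ∀ {c x} → Child c x → height T x < height T c
  child-height {c} (c≢r , refl) = height-dec T c c≢r

  child-⋡ : ∀ {c x} → Child c x → ¬ (x ≼ c)
  child-⋡ ch x≼c = <⇒≱ (child-height ch) (≼-height x≼c)

  private
    maxHeight : ℕ
    maxHeight = max 0 (map (height T) (allFin m))

    height≤max : ∀ x → height T x ≤ maxHeight
    height≤max x = All.lookup (xs≤max 0 (map (height T) (allFin m))) (∈-map⁺ (height T) (∈-allFin x))

  Child-wellFounded : WellFounded Child
  Child-wellFounded =
    Subrelation.wellFounded (λ {c} ch → ∸-monoʳ-< (child-height ch) (height≤max c))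
      (On.wellFounded (λ x → maxHeight ∸ height T x) <-wellFounded)

module Decomposition {n m : ℕ} (G : Graph n) (T' : RootedTree m) (B' : Fin m → Subset n)
                     (td : IsTreeDecomposition G (λ _ → ⊤) (TEdge T') (λ x v → v ∈ B' x)) where

  open Construction G T' B'
  open IsTreeDecomposition td
  open Components G
  open RootedTreeProperties T'

  V'-dec : ∀ x → Decidable (V' x)
  V'-dec x v = all? λ y → (v ∈? B' y) →-dec (y ≼? x)

  V'-mono : ∀ {x z v} → x ≼ z → V' x v → V' z v
  V'-mono x≼z v∈V'x y v∈y = ≼-trans (v∈V'x y v∈y) x≼z

  V'-root : ∀ v → V' (root T') v
  V'-root v y _ = ≼-root y

  Comp : Fin m → Fin n → Subset n
  Comp x = componentOf (V'-dec x)

  Comp-isComponent : ∀ {x u} → V' x u → IsComponent G (V' x) (Comp x u) × u ∈ Comp x u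
  Comp-isComponent = componentOf-isComponent (V'-dec _)

  Comp-IsSub : ∀ {x u} → V' x u → IsSub (Comp x u)
  Comp-IsSub {x} u∈V'x = x , proj₁ (Comp-isComponent u∈V'x)

  IsSub⇒≡Comp : ∀ {γ a} → IsSub γ → a ∈ γ → ∃ λ z → V' z a × γ ≡ Comp z a
  IsSub⇒≡Comp {a = a} (z , cγ@(_ , γ⊆V'z , _ , _)) a∈γ with Comp-isComponent (γ⊆V'z a a∈γ)
  ... | cC , a∈C = z , γ⊆V'z a a∈γ , component-unique cγ cC a∈γ a∈C

  component-nested : ∀ {x z α γ a} → IsComponent G (V' x) α → IsComponent G (V' z) γ →
                     x ≼ z → a ∈ α → a ∈ γ → α ⊆ γ
  component-nested cα cγ x≼z = component-⊆ cα cγ (V'-mono x≼z)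

  nested-at-shared : ∀ {α γ a} → IsSub α → IsSub γ → a ∈ α → a ∈ γ → α ⊆ γ ⊎ γ ⊆ α
  nested-at-shared {a = a} (x , cα@(_ , α⊆V'x , _ , _)) (z , cγ@(_ , γ⊆V'z , _ , _)) a∈α a∈γ with cover a
  ... | y , _ , a∈y with ≼-comparable (α⊆V'x a a∈α y a∈y) (γ⊆V'z a a∈γ y a∈y)
  ...   | inj₁ x≼z = inj₁ (component-nested cα cγ x≼z a∈α a∈γ)
  ...   | inj₂ z≼x = inj₂ (component-nested cγ cα z≼x a∈γ a∈α)

  nested-at-edge : ∀ {α γ a b} → IsSub α → IsSub γ → a ∈ α → b ∈ γ → Adj G a b → α ⊆ γ ⊎ γ ⊆ α
  nested-at-edge {a = a} {b} (x , cα@(_ , α⊆V'x , _ , α-closed)) (z , cγ@(_ , γ⊆V'z , _ , γ-closed))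
                 a∈α b∈γ ab
    with edge a b ab
  ... | y , _ , a∈y , b∈y with ≼-comparable (α⊆V'x a a∈α y a∈y) (γ⊆V'z b b∈γ y b∈y)
  ...   | inj₁ x≼z =
    inj₁ (component-nested cα cγ x≼z a∈α (γ-closed b a b∈γ (V'-mono x≼z (α⊆V'x a a∈α)) (Adj-sym ab)))
  ...   | inj₂ z≼x =
    inj₂ (component-nested cγ cα z≼x b∈γ (α-closed a b a∈α (V'-mono z≼x (γ⊆V'z b b∈γ)) ab))

  -- The nodes whose bags contain v form a subtree of T', which can leave T'_c only
  -- through the edge from c to its parent.
  stays-below : ∀ {v c y₀ y} → ¬ (v ∈ B' c × c ≢ root T' × v ∈ B' (parent T' c)) →
                v ∈ B' y₀ → v ∈ B' y → y₀ ≼ c → y ≼ c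
  stays-below {v} {c} no-exit v∈y₀ v∈y = walk-preserves (_≼ c) step (coherent v _ _ tt tt v∈y₀ v∈y)
    where
    step : ∀ {a b} → ⊤ × v ∈ B' a → a ≼ c → TEdge T' a b → ⊤ × v ∈ B' b → b ≼ c
    step (_ , v∈c) here     (inj₁ (c≢r , refl)) (_ , v∈pc) = ⊥-elim (no-exit (v∈c , c≢r , v∈pc))
    step _         (up _ p) (inj₁ (_ , refl))   _          = p
    step _         a≼c      (inj₂ (b≢r , refl)) _          = up b≢r a≼c

  V'-child : ∀ {x c v y} → v ∉ B' x → Child c x → v ∈ B' y → y ≼ c → V' c v
  V'-child v∉x (_ , refl) v∈y y≼c y′ v∈y′ = stays-below (λ { (_ , _ , v∈x) → v∉x v∈x }) v∈y v∈y′ y≼c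

  V'-descend : ∀ {x v} → V' x v → v ∉ B' x → ∃ λ c → Child c x × V' c v
  V'-descend {x} {v} v∈V'x v∉x with cover v
  ... | y , _ , v∈y with ≼-child (v∈V'x y v∈y) (λ { refl → v∉x v∈y })
  ...   | c , ch , y≼c = c , ch , V'-child v∉x ch v∈y y≼c

  V'-child-adjacent : ∀ {x c a b} → Child c x → V' c a → Adj G a b → b ∉ B' x → V' c b
  V'-child-adjacent {a = a} {b} ch a∈V'c ab b∉x with edge a b ab
  ... | y , _ , a∈y , b∈y = V'-child b∉x ch b∈y (a∈V'c y a∈y)

  component-descend : ∀ {x α} → IsComponent G (V' x) α → (∀ {v} → v ∈ α → v ∉ B' x) →
                      ∃ λ c → Child c x × IsComponent G (V' c) α
  component-descend {x} {α} ((u , u∈α) , α⊆V'x , connected , closed) misses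
    with V'-descend (α⊆V'x u u∈α) (misses u∈α)
  ... | c , ch , u∈V'c = c , ch , ((u , u∈α) , α⊆V'c , connected , closed-c)
    where
    α⊆V'c : ∀ a → a ∈ α → V' c a
    α⊆V'c a a∈α = walk-preserves (V' c) (λ _ a∈V'c ab b∈α → V'-child-adjacent ch a∈V'c ab (misses b∈α))
                                 (connected u a u∈α a∈α) u∈V'c
    closed-c : ∀ a b → a ∈ α → V' c b → Adj G a b → b ∈ α
    closed-c a b a∈α b∈V'c = closed a b a∈α (V'-mono (child≼ ch) b∈V'c)

  A-intro : ∀ {x α v} → IsComponent G (V' x) α → v ∈ α → v ∈ B' x → A α v
  A-intro {x} cα v∈α v∈x =
    v∈α , λ { γ (z , cγ@(_ , γ⊆V'z , _ , _)) v∈γ → component-nested cα cγ (γ⊆V'z _ v∈γ x v∈x) v∈α v∈γ }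

  A-unique : ∀ α β v → IsSub α → IsSub β → A α v → A β v → α ≡ β
  A-unique α β v α-sub β-sub (v∈α , α-least) (v∈β , β-least) =
    ⊆-antisym (α-least β β-sub v∈β) (β-least α α-sub v∈α)

  record Anchor (α : Subset n) : Set where
    field
      node        : Fin m
      isComponent : IsComponent G (V' node) α
      vertex      : Fin n
      vertex∈α    : vertex ∈ α
      vertex∈B'   : vertex ∈ B' node

  anchor-below : ∀ {x α} → Acc Child x → IsComponent G (V' x) α → Anchor α
  anchor-below {x} {α} (acc rs) cα with any? (λ v → (v ∈? α) ×-dec (v ∈? B' x))
  ... | yes (v , v∈α , v∈x) = record { isComponent = cα ; vertex∈α = v∈α ; vertex∈B' = v∈x }
  ... | no misses with component-descend cα (λ v∈α v∈x → misses (_ , v∈α , v∈x))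
  ...   | c , ch , cα′ = anchor-below (rs ch) cα′

  IsSub⇒Anchor : ∀ {α} → IsSub α → Anchor α
  IsSub⇒Anchor (x , cα) = anchor-below (Child-wellFounded x) cα

  A-nonempty : ∀ α → IsSub α → ∃ λ v → A α v
  A-nonempty α α-sub = vertex , A-intro isComponent vertex∈α vertex∈B'
    where open Anchor (IsSub⇒Anchor α-sub)

  least-member-below : ∀ {x v} → Acc Child x → V' x v → ∃ λ α → IsSub α × A α v
  least-member-below {x} {v} (acc rs) v∈V'x with v ∈? B' x
  ... | yes v∈x = Comp x v , Comp-IsSub v∈V'x , A-intro cC v∈C v∈x
    where
    cC : IsComponent G (V' x) (Comp x v)
    cC = proj₁ (Comp-isComponent v∈V'x)
    v∈C : v ∈ Comp x v
    v∈C = proj₂ (Comp-isComponent v∈V'x)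
  ... | no v∉x with V'-descend v∈V'x v∉x
  ...   | c , ch , v∈V'c = least-member-below (rs ch) v∈V'c

  least-member : ∀ v → ∃ λ α → IsSub α × A α v
  least-member v = least-member-below (Child-wellFounded (root T')) (V'-root v)

  module _ {α : Subset n} (an : Anchor α) where
    open Anchor an
    private
      α⊆V' : ∀ v → v ∈ α → V' node v
      α⊆V' = proj₁ (proj₂ isComponent)

      α-closed : ∀ u w → u ∈ α → V' node w → Adj G u w → w ∈ α
      α-closed = proj₂ (proj₂ (proj₂ isComponent))

    -- Otherwise v ∈ V'_c for a child c of the node, and the member of V'_c containing v
    -- would contain α and hence the vertex of α in B'_node, which is not in V'_c.
    A⊆B' : ∀ {v} → A α v → v ∈ B' node
    A⊆B' {v} (v∈α , α-least) = decidable-stable (v ∈? B' node) in-bag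
      where
      in-bag : ¬ v ∉ B' node
      in-bag v∉x with V'-descend (α⊆V' v v∈α) v∉x
      ... | c , ch , v∈V'c with Comp-isComponent v∈V'c
      ...   | cγ@(_ , γ⊆V'c , _ , _) , v∈γ =
        child-⋡ ch (γ⊆V'c vertex (α-least (Comp c v) (c , cγ) v∈γ vertex∈α) node vertex∈B')

    Nbr⊆B' : ∀ {v} → Nbr α v → v ∈ B' node
    Nbr⊆B' {v} (v∉α , w , w∈α , wv) =
      decidable-stable (v ∈? B' node) λ v∉x → v∉α (α-closed w v w∈α (v∈V' v∉x) wv)
      where
      v∈V' : v ∉ B' node → V' node v
      v∈V' v∉x y v∈y with edge w v wv
      ... | y′ , _ , w∈y′ , v∈y′ = stays-below (λ { (v∈x , _) → v∉x v∈x }) v∈y′ v∈y (α⊆V' w w∈α y′ w∈y′)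

    B⊆B' : ∀ {v} → B α v → v ∈ B' node
    B⊆B' (inj₁ a)   = A⊆B' a
    B⊆B' (inj₂ nbr) = Nbr⊆B' nbr

    B-dec : Decidable (B α)
    B-dec v with v ∈? α
    ... | yes v∈α = map′ (inj₁ ∘ A-intro isComponent v∈α) B⊆B' (v ∈? B' node)
    ... | no v∉α  = map′ (λ (w , w∈α , wv) → inj₂ (v∉α , w , w∈α , wv)) from-B
                         (any? λ w → (w ∈? α) ×-dec T? (adj G w v))
      where
      from-B : B α v → ∃ λ w → w ∈ α × Adj G w v
      from-B (inj₁ (v∈α , _))  = ⊥-elim (v∉α v∈α)
      from-B (inj₂ (_ , nbr)) = nbr

  B-bounded : ∀ {t α} → (∀ x → ∣ B' x ∣ ≤ t) → IsSub α → CardLe (B α) t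
  B-bounded bags-bounded α-sub = CardLe-⊆ (B-dec an) (B⊆B' an) (bags-bounded (Anchor.node an))
    where an = IsSub⇒Anchor α-sub

  B-cover : ∀ v → ∃ λ α → IsSub α × B α v
  B-cover v with least-member v
  ... | α , α-sub , A-α-v = α , α-sub , inj₁ A-α-v

  B-edge : ∀ u v → Adj G u v → ∃ λ α → IsSub α × B α u × B α v
  B-edge u v uv with least-member u
  ... | μ , μ-sub , A-μ-u@(u∈μ , μ-least) with v ∈? μ
  ...   | no v∉μ = μ , μ-sub , inj₁ A-μ-u , inj₂ (v∉μ , u , u∈μ , uv)
  ...   | yes v∈μ with least-member v
  ...     | ν , ν-sub , A-ν-v@(v∈ν , ν-least) with u ∈? ν
  ...       | no u∉ν  = ν , ν-sub , inj₂ (u∉ν , v , v∈ν , Adj-sym uv) , inj₁ A-ν-v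
  ...       | yes u∈ν = ν , ν-sub , inj₁ (u∈ν , ν-least-for-u) , inj₁ A-ν-v
    where
    ν-least-for-u : ∀ γ → IsSub γ → u ∈ γ → ν ⊆ γ
    ν-least-for-u γ γ-sub u∈γ = ⊆-trans (ν-least μ μ-sub v∈μ) (μ-least γ γ-sub u∈γ)

  ¬between⇒ParentT : ∀ {α δ a₀} → IsSub α → IsSub δ → α ⊂ δ → a₀ ∈ α →
                     ¬ (∃ λ z → V' z a₀ × α ⊂ Comp z a₀ × Comp z a₀ ⊂ δ) → ParentT δ α
  ¬between⇒ParentT {α} {δ} {a₀} α-sub δ-sub α⊂δ@(α⊆δ , _) a₀∈α nothing-between =
    α-sub , δ-sub , α⊆δ , ⊂⇒≢ α⊂δ , δ-least
    where
    δ-least : ∀ γ → IsSub γ → α ⊆ γ → α ≢ γ → δ ⊆ γ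
    δ-least γ γ-sub α⊆γ α≢γ with nested-at-shared δ-sub γ-sub (α⊆δ a₀∈α) (α⊆γ a₀∈α) | γ ≟ˢ δ
    ... | inj₁ δ⊆γ | _        = δ⊆γ
    ... | inj₂ _   | yes refl = ⊆-refl
    ... | inj₂ γ⊆δ | no γ≢δ with IsSub⇒≡Comp γ-sub (α⊆γ a₀∈α)
    ...   | z , a₀∈V'z , refl = ⊥-elim (nothing-between (z , a₀∈V'z , ⊆∧≢⇒⊂ α⊆γ α≢γ , ⊆∧≢⇒⊂ γ⊆δ γ≢δ))

  parent-below : ∀ {α δ} → IsSub α → Acc _⊂_ δ → IsSub δ → α ⊂ δ → ∃ λ β → ParentT β α × β ⊆ δ
  parent-below {α} {δ} α-sub@(_ , (a₀ , a₀∈α) , _) (acc rs) δ-sub α⊂δ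
    with any? (λ z → V'-dec z a₀ ×-dec ((α ⊂? Comp z a₀) ×-dec (Comp z a₀ ⊂? δ)))
  ... | no nothing-between = δ , ¬between⇒ParentT α-sub δ-sub α⊂δ a₀∈α nothing-between , ⊆-refl
  ... | yes (z , a₀∈V'z , α⊂γ , γ⊂δ@(γ⊆δ , _)) with parent-below α-sub (rs γ⊂δ) (Comp-IsSub a₀∈V'z) α⊂γ
  ...   | β , β-parent , β⊆γ = β , β-parent , ⊆-trans β⊆γ γ⊆δ

  walk-up : ∀ {α δ} → Acc _⊃_ α → IsSub α → IsSub δ → α ⊆ δ →
            Walk (λ γ → IsSub γ × α ⊆ γ × γ ⊆ δ) TE α δ
  walk-up {α} {δ} (acc rs) α-sub δ-sub α⊆δ with α ≟ˢ δ
  ... | yes refl = nil (α-sub , ⊆-refl , ⊆-refl)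
  ... | no α≢δ with parent-below α-sub (⊂-wellFounded δ) δ-sub (⊆∧≢⇒⊂ α⊆δ α≢δ)
  ...   | β , β-parent@(_ , β-sub , α⊆β , α≢β , _) , β⊆δ =
    cons (α-sub , ⊆-refl , α⊆δ) (inj₂ β-parent)
         (walk-map (λ (γ-sub , β⊆γ , γ⊆δ) → γ-sub , ⊆-trans α⊆β β⊆γ , γ⊆δ)
                   (walk-up (rs (⊆∧≢⇒⊂ α⊆β α≢β)) β-sub δ-sub β⊆δ))

  walk-to-least : ∀ {α μ v} → IsSub α → IsSub μ → A μ v → B α v → Walk (λ γ → IsSub γ × B γ v) TE α μ
  walk-to-least α-sub μ-sub A-μ-v (inj₁ A-α-v) with A-unique _ _ _ α-sub μ-sub A-α-v A-μ-v
  ... | refl = nil (μ-sub , inj₁ A-μ-v)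
  walk-to-least {α} {μ} {v} α-sub μ-sub A-μ-v@(v∈μ , μ-least) (inj₂ (v∉α , w , w∈α , wv))
    with nested-at-edge α-sub μ-sub w∈α v∈μ wv
  ... | inj₂ μ⊆α = ⊥-elim (v∉α (μ⊆α v∈μ))
  ... | inj₁ α⊆μ = walk-map on-the-way (walk-up (⊃-wellFounded α) α-sub μ-sub α⊆μ)
    where
    on-the-way : ∀ {γ} → IsSub γ × α ⊆ γ × γ ⊆ μ → IsSub γ × B γ v
    on-the-way {γ} (γ-sub , α⊆γ , γ⊆μ) with v ∈? γ
    ... | yes v∈γ = γ-sub , inj₁ (v∈γ , λ δ δ-sub v∈δ → ⊆-trans γ⊆μ (μ-least δ δ-sub v∈δ))
    ... | no v∉γ  = γ-sub , inj₂ (v∉γ , w , α⊆γ w∈α , wv)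

  TE-sym : ∀ {α β} → TE α β → TE β α
  TE-sym = Sum.swap

  B-coherent : ∀ v α β → IsSub α → IsSub β → B α v → B β v → Walk (λ γ → IsSub γ × B γ v) TE α β
  B-coherent v α β α-sub β-sub v∈Bα v∈Bβ with least-member v
  ... | μ , μ-sub , A-μ-v =
    walk-to-least α-sub μ-sub A-μ-v v∈Bα ++ʷ walk-reverse TE-sym (walk-to-least β-sub μ-sub A-μ-v v∈Bβ)

lemma11 : ∀ {n m : ℕ} (t : ℕ) (G : Graph n) → Connected G →
          (T' : RootedTree m) (B' : Fin m → Subset n) →
          IsTreeDecomposition G (λ _ → ⊤) (TEdge T') (λ x v → v ∈ B' x) →
          (∀ x → ∣ B' x ∣ ≤ t) →
          let open Construction G T' B' in
          ((∀ α → IsSub α → ∃ λ v → A α v)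
           × (∀ v → ∃ λ α → IsSub α × A α v)
           × (∀ α β v → IsSub α → IsSub β → A α v → A β v → α ≡ β))
          × IsTreeDecomposition G IsSub TE B
          × (∀ α → IsSub α → CardLe (B α) t)
lemma11 t G _ T' B' td bags-bounded =
  (A-nonempty , least-member , A-unique) ,
  record { cover = B-cover ; edge = B-edge ; coherent = B-coherent } ,
  (λ α → B-bounded bags-bounded)
  where open Decomposition G T' B' td
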